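{- Let $m > a \ge 2$ be integers and let $h = \binom{m}{a+1}$. Suppose $M$ is an $a$-complete matroid with joint-set $B$, and there are disjoint sets $B_0, B_1, \dots, B_h \subseteq B$ such that $|B_0| \ge m$ and, for each $i \in \{1,\dots,h\}$, $|B_i| > a$ and there is some $x_i \in E(M)$ for which $B_i \cup \{x_i\}$ is a circuit of $M$. Then $M$ has an $(a+1)$-complete minor of rank $m$.
   Context: For an integer $a \ge 2$, a matroid $M$ is $a$-complete if it has a basis $B$ such that for every $I \subseteq B$ with $2 \le |I| \le a$ there is some $e \in E(M)$ for which $I \cup \{e\}$ is a circuit of $M$; such a $B$ is called a joint-set of $M$. -}

module Defs where

open import Data.Nat using (ℕ; _≤_; _<_; _≥_)
open import Data.Fin using (Fin)
open import Data.Fin.Subset using (Subset; ⁅_⁆; _∈_; _∉_; _⊆_; _⊂_; _∪_; _∩_; _─_; ∣_∣; ⊥; Empty)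
open import Data.Product using (Σ; ∃; _×_; ∃-syntax)
open import Relation.Nullary using (¬_; Dec)
open import Relation.Binary.PropositionalEquality using (_≡_)

-- Carrying the ground set as a subset of a fixed Fin n lets minors
-- live on the same carrier type.
record Matroid (n : ℕ) : Set₁ where
  field
    E         : Subset n
    Indep     : Subset n → Set
    Indep-dec : ∀ I → Dec (Indep I)
    Indep-⊆E  : ∀ {I} → Indep I → I ⊆ E
    I1        : Indep ⊥
    I2        : ∀ {I J} → Indep J → I ⊆ J → Indep I
    I3        : ∀ {I J} → Indep I → Indep J → ∣ I ∣ < ∣ J ∣ →
                ∃[ x ] (x ∈ J × x ∉ I × Indep (I ∪ ⁅ x ⁆))

module _ {n : ℕ} (M : Matroid n) where
  open Matroid M

  IsCircuit : Subset n → Set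
  IsCircuit C = C ⊆ E × ¬ Indep C × (∀ D → D ⊂ C → Indep D)

  IsBasisOf : Subset n → Subset n → Set
  IsBasisOf X J = J ⊆ X × Indep J × (∀ J′ → J ⊆ J′ → J′ ⊆ X → Indep J′ → J′ ≡ J)

  IsBasis : Subset n → Set
  IsBasis B = IsBasisOf E B

  HasRank : ℕ → Set
  HasRank r = ∃[ B ] (IsBasis B × ∣ B ∣ ≡ r)

  IsJointSet : ℕ → Subset n → Set
  IsJointSet a B = IsBasis B ×
    (∀ I → I ⊆ B → 2 ≤ ∣ I ∣ → ∣ I ∣ ≤ a →
       ∃[ e ] (e ∈ E × IsCircuit (I ∪ ⁅ e ⁆)))

  IsComplete : ℕ → Set
  IsComplete a = ∃[ B ] IsJointSet a B

-- N is the minor M / C \ D of M, for disjoint C, D ⊆ E(M):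
-- E(N) = E(M) − (C ∪ D), and I is independent in N iff I ⊆ E(N) and
-- I ∪ J is independent in M for some basis J of M|C (Oxley, Prop. 3.1.7).
IsMinorVia : ∀ {n} → Matroid n → Subset n → Subset n → Matroid n → Set
IsMinorVia M C D N =
  C ⊆ Matroid.E M × D ⊆ Matroid.E M × Empty (C ∩ D) ×
  Matroid.E N ≡ Matroid.E M ─ (C ∪ D) ×
  (∀ I → (Matroid.Indep N I → I ⊆ Matroid.E N × ∃[ J ] (IsBasisOf M C J × Matroid.Indep M (I ∪ J)))
       × (I ⊆ Matroid.E N → ∃[ J ] (IsBasisOf M C J × Matroid.Indep M (I ∪ J)) → Matroid.Indep N I))

IsMinor : ∀ {n} → Matroid n → Matroid n → Set
IsMinor M N = ∃[ C ] ∃[ D ] IsMinorVia M C D N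

-- Shrink B₀ to exactly m elements and enumerate its (a+1)-subsets as
-- Q₁, …, Q_h.  Pair the elements of Qᵢ with the first ∣Qᵢ∣ elements of Bᵢ.
-- For c ∈ B − B₀ paired with b, the joint-set property gives a triangle
-- {b, c, y}; let φ(c) = y, and φ(c) = c for unpaired c.  Contract
-- Y = φ(B − B₀).  Then B₀ ∪ Y spans B and is no larger than B, so it is a
-- basis of M and B₀ is a basis of M / Y.  Circuits I ∪ {e} of M with I ⊆ B₀
-- survive in M / Y, and each Qᵢ ∪ {xᵢ} becomes a circuit of M / Y, so B₀ is a
-- joint-set of M / Y for a + 1.

module Submission where

open import Defs
open import Data.Nat using (ℕ; suc; _+_; _≤_; _<_; _≥_)
open import Data.Nat.Combinatorics using (_C_)
open import Data.Fin using (Fin; zero; suc)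
open import Data.Fin.Subset using (Subset; ⁅_⁆; _∈_; _⊆_; _∪_; _∩_; ∣_∣; Empty)
open import Data.Product using (_×_; ∃-syntax)
open import Relation.Binary.PropositionalEquality using (_≡_; _≢_)

open import Data.Nat using (zero; z≤n; s≤s; _∸_; _<?_; _≤?_)
open import Data.Nat.Properties hiding (_≟_)
open import Data.Nat.Combinatorics using (nCk+nC[k+1]≡[n+1]C[k+1])
open import Data.Fin using (_≟_; toℕ; fromℕ<)
open import Data.Fin.Properties using (any?; toℕ-fromℕ<) renaming (0≢1+n to zero≢suc; suc-injective to Fin-suc-injective)
open import Data.Fin.Subset using (⊥; _∉_; _⊂_; _─_; _-_; inside; outside)
open import Data.Fin.Subset.Properties
open import Data.Vec.Base using ([]; _∷_; here; there)
open import Data.Product using (_,_; proj₁; proj₂)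
open import Data.Sum using (_⊎_; inj₁; inj₂)
open import Data.Empty using (⊥-elim) renaming (⊥ to False)
open import Function using (_∘_)
open import Relation.Nullary using (¬_; yes; no)
open import Relation.Nullary.Decidable using (_×-dec_; ¬?)
open import Relation.Binary.PropositionalEquality using (refl; sym; trans; cong; subst; subst₂; module ≡-Reasoning)

private variable
  n k : ℕ
  p q r s : Subset n
  w x y z : Fin n

∈∪ˡ : x ∈ p → x ∈ p ∪ q
∈∪ˡ x∈p = x∈p∪q⁺ (inj₁ x∈p)

∈∪ʳ : x ∈ q → x ∈ p ∪ q
∈∪ʳ x∈q = x∈p∪q⁺ (inj₂ x∈q)

∪-⊆ : p ⊆ r → q ⊆ r → p ∪ q ⊆ r
∪-⊆ {p = p} {q = q} p⊆r q⊆r x∈p∪q with x∈p∪q⁻ p q x∈p∪q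
... | inj₁ x∈p = p⊆r x∈p
... | inj₂ x∈q = q⊆r x∈q

∪-mono : p ⊆ r → q ⊆ s → p ∪ q ⊆ r ∪ s
∪-mono p⊆r q⊆s = ∪-⊆ (λ x∈p → ∈∪ˡ (p⊆r x∈p)) (λ x∈q → ∈∪ʳ (q⊆s x∈q))

⁅⁆-⊆ : x ∈ p → ⁅ x ⁆ ⊆ p
⁅⁆-⊆ {x = x} {p = p} x∈p y∈⁅x⁆ = subst (_∈ p) (sym (x∈⁅y⁆⇒x≡y x y∈⁅x⁆)) x∈p

∈─⇒∉ : x ∈ p ─ q → x ∉ q
∈─⇒∉ {x = zero} {p = s ∷ p} {q = inside ∷ q} () _
∈─⇒∉ {x = zero} {p = s ∷ p} {q = outside ∷ q} _ ()
∈─⇒∉ {x = suc x} {p = s ∷ p} {q = t ∷ q} (there h) (there h′) = ∈─⇒∉ h h′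

∈-⁻ : x ∈ p - y → x ∈ p × x ≢ y
∈-⁻ {p = p} {y = y} x∈p-y = p─q⊆p p ⁅ y ⁆ x∈p-y , x∉⁅y⁆⇒x≢y (∈─⇒∉ x∈p-y)

-⊆ : p - y ⊆ p
-⊆ x∈p-y = proj₁ (∈-⁻ x∈p-y)

Disjoint : Subset n → Subset n → Set
Disjoint p q = ∀ {x} → x ∈ p → x ∉ q

disjoint-index : ∀ {k} (F : Fin k → Subset n) → (∀ i j → i ≢ j → Empty (F i ∩ F j)) →
                 ∀ i j → x ∈ F i → x ∈ F j → i ≡ j
disjoint-index F disjoint i j x∈Fi x∈Fj with i ≟ j
... | yes i≡j = i≡j
... | no i≢j = ⊥-elim (disjoint i j i≢j (_ , x∈p∩q⁺ (x∈Fi , x∈Fj)))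

triple : Fin n → Fin n → Fin n → Subset n
triple x y z = (⁅ x ⁆ ∪ ⁅ y ⁆) ∪ ⁅ z ⁆

triple-cases : w ∈ triple x y z → w ≡ x ⊎ w ≡ y ⊎ w ≡ z
triple-cases {x = x} {y = y} {z = z} h with x∈p∪q⁻ (⁅ x ⁆ ∪ ⁅ y ⁆) ⁅ z ⁆ h
... | inj₂ h₃ = inj₂ (inj₂ (x∈⁅y⁆⇒x≡y z h₃))
... | inj₁ h₁₂ with x∈p∪q⁻ ⁅ x ⁆ ⁅ y ⁆ h₁₂
... | inj₁ h₁ = inj₁ (x∈⁅y⁆⇒x≡y x h₁)
... | inj₂ h₂ = inj₂ (inj₁ (x∈⁅y⁆⇒x≡y y h₂))

triple-swap : triple x y z ≡ triple y x z
triple-swap {x = x} {y = y} {z = z} = cong (_∪ ⁅ z ⁆) (∪-comm ⁅ x ⁆ ⁅ y ⁆)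

triple-⊆ : x ∈ p → y ∈ p → z ∈ p → triple x y z ⊆ p
triple-⊆ x∈p y∈p z∈p = ∪-⊆ (∪-⊆ (⁅⁆-⊆ x∈p) (⁅⁆-⊆ y∈p)) (⁅⁆-⊆ z∈p)

∣∪∣≤ : ∀ (p q : Subset n) → ∣ p ∪ q ∣ ≤ ∣ p ∣ + ∣ q ∣
∣∪∣≤ [] [] = z≤n
∣∪∣≤ (inside ∷ p) (inside ∷ q) = s≤s (≤-trans (∣∪∣≤ p q) (+-monoʳ-≤ ∣ p ∣ (n≤1+n ∣ q ∣)))
∣∪∣≤ (inside ∷ p) (outside ∷ q) = s≤s (∣∪∣≤ p q)
∣∪∣≤ (outside ∷ p) (inside ∷ q) = ≤-trans (s≤s (∣∪∣≤ p q)) (≤-reflexive (sym (+-suc ∣ p ∣ ∣ q ∣)))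
∣∪∣≤ (outside ∷ p) (outside ∷ q) = ∣∪∣≤ p q

∣∪∣-disjoint : ∀ (p q : Subset n) → Disjoint p q → ∣ p ∪ q ∣ ≡ ∣ p ∣ + ∣ q ∣
∣∪∣-disjoint [] [] _ = refl
∣∪∣-disjoint (inside ∷ p) (inside ∷ q) d = ⊥-elim (d here here)
∣∪∣-disjoint (inside ∷ p) (outside ∷ q) d = cong suc (∣∪∣-disjoint p q (λ h h′ → d (there h) (there h′)))
∣∪∣-disjoint (outside ∷ p) (inside ∷ q) d =
  trans (cong suc (∣∪∣-disjoint p q (λ h h′ → d (there h) (there h′)))) (sym (+-suc ∣ p ∣ ∣ q ∣))
∣∪∣-disjoint (outside ∷ p) (outside ∷ q) d = ∣∪∣-disjoint p q (λ h h′ → d (there h) (there h′))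

∣∪⁅⁆∣ : x ∉ p → ∣ p ∪ ⁅ x ⁆ ∣ ≡ suc ∣ p ∣
∣∪⁅⁆∣ {x = x} {p = p} x∉p = begin
  ∣ p ∪ ⁅ x ⁆ ∣      ≡⟨ ∣∪∣-disjoint p ⁅ x ⁆ (λ y∈p y∈⁅x⁆ → x∉p (subst (_∈ p) (x∈⁅y⁆⇒x≡y x y∈⁅x⁆) y∈p)) ⟩
  ∣ p ∣ + ∣ ⁅ x ⁆ ∣  ≡⟨ cong (∣ p ∣ +_) (∣⁅x⁆∣≡1 x) ⟩
  ∣ p ∣ + 1          ≡⟨ +-comm ∣ p ∣ 1 ⟩
  suc ∣ p ∣          ∎
  where open ≡-Reasoning

∣∣+∣─∣ : ∀ (p q : Subset n) → q ⊆ p → ∣ q ∣ + ∣ p ─ q ∣ ≡ ∣ p ∣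
∣∣+∣─∣ [] [] _ = refl
∣∣+∣─∣ (inside ∷ p) (inside ∷ q) q⊆p = cong suc (∣∣+∣─∣ p q (drop-∷-⊆ q⊆p))
∣∣+∣─∣ (outside ∷ p) (inside ∷ q) q⊆p with q⊆p here
... | ()
∣∣+∣─∣ (inside ∷ p) (outside ∷ q) q⊆p = trans (+-suc ∣ q ∣ _) (cong suc (∣∣+∣─∣ p q (drop-∷-⊆ q⊆p)))
∣∣+∣─∣ (outside ∷ p) (outside ∷ q) q⊆p = ∣∣+∣─∣ p q (drop-∷-⊆ q⊆p)

⊆-size-≡ : p ⊆ q → ∣ q ∣ ≤ ∣ p ∣ → p ≡ q
⊆-size-≡ {p = p} {q = q} p⊆q ∣q∣≤∣p∣ = ⊆-antisym p⊆q q⊆p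
  where
  q⊆p : q ⊆ p
  q⊆p {x} x∈q with x ∈? p
  ... | yes x∈p = x∈p
  ... | no x∉p = ⊥-elim (<⇒≱ (p⊂q⇒∣p∣<∣q∣ (p⊆q , x , x∈q , x∉p)) ∣q∣≤∣p∣)

choose : ∀ (p : Subset n) k → k ≤ ∣ p ∣ → ∃[ q ] (q ⊆ p × ∣ q ∣ ≡ k)
choose {n} p zero _ = ⊥ , ⊥⊆ , ∣⊥∣≡0 n
choose (outside ∷ p) (suc k) k<∣p∣ with choose p (suc k) k<∣p∣
... | q , q⊆p , ∣q∣≡k = outside ∷ q , out⊆ q⊆p , ∣q∣≡k
choose (inside ∷ p) (suc k) (s≤s k≤∣p∣) with choose p k k≤∣p∣
... | q , q⊆p , ∣q∣≡k = inside ∷ q , in⊆in q⊆p , cong suc ∣q∣≡k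

nonempty : 0 < ∣ p ∣ → ∃[ x ] x ∈ p
nonempty {p = inside ∷ p} _ = zero , here
nonempty {p = outside ∷ p} 0<∣p∣ with nonempty {p = p} 0<∣p∣
... | x , x∈p = suc x , there x∈p

-- Positions: pos p x counts the elements of p before x.  On p it is a
-- bijection onto {0, …, ∣p∣ - 1}; it is used to pair up two sets element by element.

pos : Subset n → Fin n → ℕ
pos (s ∷ p) zero = 0
pos (inside ∷ p) (suc x) = suc (pos p x)
pos (outside ∷ p) (suc x) = pos p x

pos< : ∀ (p : Subset n) → x ∈ p → pos p x < ∣ p ∣
pos< (inside ∷ p) here = s≤s z≤n
pos< (inside ∷ p) (there x∈p) = s≤s (pos< p x∈p)
pos< (outside ∷ p) (there x∈p) = pos< p x∈p

pos-injective : ∀ (p : Subset n) → x ∈ p → y ∈ p → pos p x ≡ pos p y → x ≡ y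
pos-injective (s ∷ p) here here _ = refl
pos-injective (inside ∷ p) here (there _) ()
pos-injective (inside ∷ p) (there _) here ()
pos-injective (inside ∷ p) (there x∈p) (there y∈p) e = cong suc (pos-injective p x∈p y∈p (suc-injective e))
pos-injective (outside ∷ p) (there x∈p) (there y∈p) e = cong suc (pos-injective p x∈p y∈p e)

pos-surjective : ∀ (p : Subset n) j → j < ∣ p ∣ → ∃[ x ] (x ∈ p × pos p x ≡ j)
pos-surjective (inside ∷ p) zero _ = zero , here , refl
pos-surjective (inside ∷ p) (suc j) (s≤s j<∣p∣) with pos-surjective p j j<∣p∣
... | x , x∈p , e = suc x , there x∈p , cong suc e
pos-surjective (outside ∷ p) j j<∣p∣ with pos-surjective p j j<∣p∣
... | x , x∈p , e = suc x , there x∈p , e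

-- Enumeration of k-subsets: unrank p k r is the r-th k-subset of p, where the
-- k-subsets of inside ∷ p containing the head (∣ p ∣ C (k - 1) of them) come
-- first.

unrank : Subset n → ℕ → ℕ → Subset n
unrank [] k r = []
unrank (outside ∷ p) k r = outside ∷ unrank p k r
unrank (inside ∷ p) zero r = outside ∷ unrank p zero r
unrank (inside ∷ p) (suc k) r with r <? ∣ p ∣ C k
... | yes _ = inside ∷ unrank p k r
... | no _ = outside ∷ unrank p (suc k) (r ∸ ∣ p ∣ C k)

unrank-⊆ : ∀ (p : Subset n) k r → unrank p k r ⊆ p
unrank-⊆ (outside ∷ p) k r (there h) = there (unrank-⊆ p k r h)
unrank-⊆ (inside ∷ p) zero r (there h) = there (unrank-⊆ p zero r h)
unrank-⊆ (inside ∷ p) (suc k) r h with r <? ∣ p ∣ C k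
unrank-⊆ (inside ∷ p) (suc k) r here | yes _ = here
unrank-⊆ (inside ∷ p) (suc k) r (there h) | yes _ = there (unrank-⊆ p k r h)
unrank-⊆ (inside ∷ p) (suc k) r (there h) | no _ = there (unrank-⊆ p (suc k) _ h)

unrank-size : ∀ (p : Subset n) k r → ∣ unrank p k r ∣ ≤ k
unrank-size [] k r = z≤n
unrank-size (outside ∷ p) k r = unrank-size p k r
unrank-size (inside ∷ p) zero r = unrank-size p zero r
unrank-size (inside ∷ p) (suc k) r with r <? ∣ p ∣ C k
... | yes _ = s≤s (unrank-size p k r)
... | no _ = unrank-size p (suc k) _

unrank-onto : ∀ (p q : Subset n) k → q ⊆ p → ∣ q ∣ ≡ k → ∃[ r ] (r < ∣ p ∣ C k × unrank p k r ≡ q)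
unrank-onto [] [] zero _ _ = 0 , s≤s z≤n , refl
unrank-onto (outside ∷ p) (outside ∷ q) k q⊆p e with unrank-onto p q k (drop-∷-⊆ q⊆p) e
... | r , r< , eq = r , r< , cong (outside ∷_) eq
unrank-onto (outside ∷ p) (inside ∷ q) k q⊆p e with q⊆p here
... | ()
unrank-onto (inside ∷ p) (outside ∷ q) zero q⊆p e with unrank-onto p q zero (drop-∷-⊆ q⊆p) e
... | r , r< , eq = r , r< , cong (outside ∷_) eq
unrank-onto (inside ∷ p) (inside ∷ q) (suc k) q⊆p refl with unrank-onto p q k (drop-∷-⊆ q⊆p) refl
... | r , r< , eq = r , r<′ , eq′
  where
  r<′ : r < suc ∣ p ∣ C suc k
  r<′ = subst (r <_) (nCk+nC[k+1]≡[n+1]C[k+1] ∣ p ∣ k) (≤-trans r< (m≤m+n _ _))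
  eq′ : unrank (inside ∷ p) (suc k) r ≡ inside ∷ q
  eq′ with r <? ∣ p ∣ C k
  ... | yes _ = cong (inside ∷_) eq
  ... | no r≮ = ⊥-elim (r≮ r<)
unrank-onto (inside ∷ p) (outside ∷ q) (suc k) q⊆p e with unrank-onto p q (suc k) (drop-∷-⊆ q⊆p) e
... | r , r< , eq = ∣ p ∣ C k + r , r<′ , eq′
  where
  r<′ : ∣ p ∣ C k + r < suc ∣ p ∣ C suc k
  r<′ = subst (∣ p ∣ C k + r <_) (nCk+nC[k+1]≡[n+1]C[k+1] ∣ p ∣ k) (+-monoʳ-< (∣ p ∣ C k) r<)
  eq′ : unrank (inside ∷ p) (suc k) (∣ p ∣ C k + r) ≡ outside ∷ q
  eq′ with ∣ p ∣ C k + r <? ∣ p ∣ C k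
  ... | yes r+< = ⊥-elim (<⇒≱ r+< (m≤m+n _ _))
  ... | no _ = cong (outside ∷_) (trans (cong (unrank p (suc k)) (m+n∸m≡n (∣ p ∣ C k) r)) eq)

image : (Fin n → Fin k) → Subset n → Subset k
image f [] = ⊥
image f (inside ∷ p) = ⁅ f zero ⁆ ∪ image (f ∘ suc) p
image f (outside ∷ p) = image (f ∘ suc) p

image-size : ∀ (f : Fin n → Fin k) p → ∣ image f p ∣ ≤ ∣ p ∣
image-size {k = k} f [] = ≤-reflexive (∣⊥∣≡0 k)
image-size f (inside ∷ p) = begin
  ∣ ⁅ f zero ⁆ ∪ image (f ∘ suc) p ∣          ≤⟨ ∣∪∣≤ ⁅ f zero ⁆ _ ⟩
  ∣ ⁅ f zero ⁆ ∣ + ∣ image (f ∘ suc) p ∣       ≡⟨ cong (_+ ∣ image (f ∘ suc) p ∣) (∣⁅x⁆∣≡1 (f zero)) ⟩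
  suc ∣ image (f ∘ suc) p ∣                    ≤⟨ s≤s (image-size (f ∘ suc) p) ⟩
  suc ∣ p ∣                                    ∎
  where open ≤-Reasoning
image-size f (outside ∷ p) = image-size (f ∘ suc) p

image-∈ : ∀ (f : Fin n → Fin k) → x ∈ p → f x ∈ image f p
image-∈ {p = inside ∷ p} f here = ∈∪ˡ (x∈⁅x⁆ (f zero))
image-∈ {p = inside ∷ p} f (there x∈p) = ∈∪ʳ (image-∈ (f ∘ suc) x∈p)
image-∈ {p = outside ∷ p} f (there x∈p) = image-∈ (f ∘ suc) x∈p

image-∈⁻ : ∀ (f : Fin n → Fin k) p {y} → y ∈ image f p → ∃[ x ] (x ∈ p × f x ≡ y)
image-∈⁻ f [] y∈ = ⊥-elim (∉⊥ y∈)
image-∈⁻ f (inside ∷ p) y∈ with x∈p∪q⁻ ⁅ f zero ⁆ _ y∈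
... | inj₁ y∈⁅f0⁆ = zero , here , sym (x∈⁅y⁆⇒x≡y _ y∈⁅f0⁆)
... | inj₂ y∈img with image-∈⁻ (f ∘ suc) p y∈img
... | x , x∈p , e = suc x , there x∈p , e
image-∈⁻ f (outside ∷ p) y∈ with image-∈⁻ (f ∘ suc) p y∈
... | x , x∈p , e = suc x , there x∈p , e

-- Closure in a matroid.  We only need closures of independent sets K, where
-- x is spanned by K when x ∈ K or K ∪ {x} is dependent.
module Closure {n : ℕ} (M : Matroid n) where
  open Matroid M

  infix 4 _∈cl_ _⊆cl_

  _∈cl_ : Fin n → Subset n → Set
  x ∈cl K = x ∈ K ⊎ ¬ Indep (K ∪ ⁅ x ⁆)

  _⊆cl_ : Subset n → Subset n → Set
  Y ⊆cl K = ∀ {y} → y ∈ Y → y ∈cl K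

  private variable
    K W X Y Z : Subset n

  ∉cl⇒Indep : ¬ x ∈cl K → Indep (K ∪ ⁅ x ⁆)
  ∉cl⇒Indep {x} {K} x∉clK with Indep-dec (K ∪ ⁅ x ⁆)
  ... | yes ind = ind
  ... | no dep = ⊥-elim (x∉clK (inj₂ dep))

  -- Rank bound: an independent set spanned by an independent K is no larger
  -- than K (otherwise augmentation would add an element outside the closure).
  spanned-size : Indep K → Indep Y → Y ⊆cl K → ∣ Y ∣ ≤ ∣ K ∣
  spanned-size {K} {Y} iK iY Y⊆clK with ∣ Y ∣ ≤? ∣ K ∣
  ... | yes ∣Y∣≤∣K∣ = ∣Y∣≤∣K∣
  ... | no ∣Y∣≰∣K∣ with I3 iK iY (≰⇒> ∣Y∣≰∣K∣)
  ... | y , y∈Y , y∉K , ind with Y⊆clK y∈Y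
  ...   | inj₁ y∈K = ⊥-elim (y∉K y∈K)
  ...   | inj₂ dep = ⊥-elim (dep ind)

  augment : Indep X → Indep W → ∀ k → ∣ X ∣ + k ≤ ∣ W ∣ →
            ∃[ X′ ] (X ⊆ X′ × X′ ⊆ X ∪ W × Indep X′ × ∣ X′ ∣ ≡ ∣ X ∣ + k)
  augment {X} iX iW zero _ = X , (λ h → h) , ∈∪ˡ , iX , sym (+-identityʳ _)
  augment {X} {W} iX iW (suc k) bound
    with augment iX iW k (≤-trans (+-monoʳ-≤ ∣ X ∣ (n≤1+n k)) bound)
  ... | X′ , X⊆X′ , X′⊆X∪W , iX′ , ∣X′∣≡ with I3 iX′ iW ∣X′∣<∣W∣
    where
    ∣X′∣<∣W∣ : ∣ X′ ∣ < ∣ W ∣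
    ∣X′∣<∣W∣ = subst (_< ∣ W ∣) (sym ∣X′∣≡) (subst (_≤ ∣ W ∣) (+-suc ∣ X ∣ k) bound)
  ... | w , w∈W , w∉X′ , ind =
    X′ ∪ ⁅ w ⁆ , (λ h → ∈∪ˡ (X⊆X′ h)) , ∪-⊆ X′⊆X∪W (⁅⁆-⊆ (∈∪ʳ w∈W)) , ind ,
    trans (∣∪⁅⁆∣ w∉X′) (trans (cong suc ∣X′∣≡) (sym (+-suc ∣ X ∣ k)))

  circuit-closure : Indep K → IsCircuit M Z → z ∈ Z → Z - z ⊆cl K → z ∈cl K
  circuit-closure {K} {Z} {z} iK (_ , Z-dep , Z-minimal) z∈Z rest⊆clK with z ∈? K | Indep-dec (K ∪ ⁅ z ⁆)
  ... | yes z∈K | _ = inj₁ z∈K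
  ... | no _ | no dep = inj₂ dep
  ... | no z∉K | yes iKz = ⊥-elim impossible
    where
    -- Z - z is independent and spanned by K; extend it inside (Z - z) ∪ K ∪ {z}
    -- to an independent X′ of size ∣ K ∣ + 1.  Then X′ contains z (so Z ⊆ X′
    -- would be independent) or X′ is spanned by K (contradicting the rank bound).
    iX : Indep (Z - z)
    iX = Z-minimal (Z - z) (x∈p⇒p-x⊂p z∈Z)
    ∣Z-z∣≤∣K∣ : ∣ Z - z ∣ ≤ ∣ K ∣
    ∣Z-z∣≤∣K∣ = spanned-size iK iX rest⊆clK
    target : ∣ Z - z ∣ + (suc ∣ K ∣ ∸ ∣ Z - z ∣) ≡ suc ∣ K ∣
    target = m+[n∸m]≡n (≤-trans ∣Z-z∣≤∣K∣ (n≤1+n _))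
    impossible : False
    impossible with augment iX iKz (suc ∣ K ∣ ∸ ∣ Z - z ∣) (≤-reflexive (trans target (sym (∣∪⁅⁆∣ z∉K))))
    ... | X′ , X⊆X′ , X′⊆ , iX′ , ∣X′∣≡ with z ∈? X′
    ...   | yes z∈X′ = Z-dep (I2 iX′ Z⊆X′)
      where
      Z⊆X′ : Z ⊆ X′
      Z⊆X′ {y} y∈Z with y ≟ z
      ... | yes refl = z∈X′
      ... | no y≢z = X⊆X′ (x∈p∧x≢y⇒x∈p-y y∈Z y≢z)
    ...   | no z∉X′ = <⇒≱ (≤-reflexive (sym (trans ∣X′∣≡ target))) (spanned-size iK iX′ X′⊆clK)
      where
      X′⊆clK : X′ ⊆cl K
      X′⊆clK {y} y∈X′ with x∈p∪q⁻ (Z - z) _ (X′⊆ y∈X′)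
      ... | inj₁ y∈X = rest⊆clK y∈X
      ... | inj₂ y∈Kz with x∈p∪q⁻ K ⁅ z ⁆ y∈Kz
      ...   | inj₁ y∈K = inj₁ y∈K
      ...   | inj₂ y∈⁅z⁆ = ⊥-elim (z∉X′ (subst (_∈ X′) (x∈⁅y⁆⇒x≡y z y∈⁅z⁆) y∈X′))

  triangle-closure : Indep K → IsCircuit M (triple x y z) → y ∈cl K → z ∈cl K → x ∈cl K
  triangle-closure {K} {x} {y} {z} iK triangle y∈clK z∈clK =
    circuit-closure iK triangle (∈∪ˡ (∈∪ˡ (x∈⁅x⁆ x))) others
    where
    others : triple x y z - x ⊆cl K
    others w∈ with ∈-⁻ w∈
    ... | w∈T , w≢x with triple-cases w∈T
    ...   | inj₁ w≡x = ⊥-elim (w≢x w≡x)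
    ...   | inj₂ (inj₁ refl) = y∈clK
    ...   | inj₂ (inj₂ refl) = z∈clK

  basis-size : IsBasis M X → Indep Y → ∣ Y ∣ ≤ ∣ X ∣
  basis-size {X} {Y} (X⊆E , iX , X-maximal) iY = spanned-size iX iY Y⊆clX
    where
    Y⊆clX : Y ⊆cl X
    Y⊆clX {y} y∈Y with y ∈? X
    ... | yes y∈X = inj₁ y∈X
    ... | no y∉X = inj₂ λ ind → y∉X (subst (y ∈_)
            (X-maximal (X ∪ ⁅ y ⁆) ∈∪ˡ (∪-⊆ X⊆E (⁅⁆-⊆ (Indep-⊆E iY y∈Y))) ind) (∈∪ʳ (x∈⁅x⁆ y)))

  maximal-independent : ∀ S → ∃[ K ] (K ⊆ S × Indep K × S ⊆cl K)
  maximal-independent S = grow n ⊥ ⊥⊆ I1 (≤-reflexive (sym (cong (_+ n) (∣⊥∣≡0 n))))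
    where
    -- Add elements of S while independence is kept; as ∣ K ∣ ≤ n, the
    -- fuel n - ∣ K ∣ bounds the number of additions.
    grow : ∀ fuel K → K ⊆ S → Indep K → n ≤ ∣ K ∣ + fuel → ∃[ K′ ] (K′ ⊆ S × Indep K′ × S ⊆cl K′)
    grow fuel K K⊆S iK bound with any? (λ s → s ∈? S ×-dec ¬? (s ∈? K) ×-dec Indep-dec (K ∪ ⁅ s ⁆))
    ... | no stuck = K , K⊆S , iK , S⊆clK
      where
      S⊆clK : S ⊆cl K
      S⊆clK {s} s∈S with s ∈? K
      ... | yes s∈K = inj₁ s∈K
      ... | no s∉K = inj₂ λ ind → stuck (s , s∈S , s∉K , ind)
    grow zero K _ _ bound | yes (s , _ , s∉K , _) =
      ⊥-elim (<⇒≱ (subst (_≤ n) (∣∪⁅⁆∣ s∉K) (∣p∣≤n (K ∪ ⁅ s ⁆))) (subst (n ≤_) (+-identityʳ _) bound))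
    grow (suc fuel) K K⊆S _ bound | yes (s , s∈S , s∉K , ind) =
      grow fuel (K ∪ ⁅ s ⁆) (∪-⊆ K⊆S (⁅⁆-⊆ s∈S)) ind
        (subst (n ≤_) (trans (+-suc ∣ K ∣ fuel) (cong (_+ fuel) (sym (∣∪⁅⁆∣ s∉K)))) bound)

  small-spanning-independent : ∀ {S J} → Indep J → ∣ S ∣ ≤ ∣ J ∣ →
                               (∀ {K} → Indep K → S ⊆cl K → J ⊆cl K) → Indep S
  small-spanning-independent {S} {J} iJ ∣S∣≤∣J∣ transfer with maximal-independent S
  ... | K , K⊆S , iK , S⊆clK = subst Indep (⊆-size-≡ K⊆S ∣S∣≤∣K∣) iK
    where
    ∣S∣≤∣K∣ : ∣ S ∣ ≤ ∣ K ∣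
    ∣S∣≤∣K∣ = ≤-trans ∣S∣≤∣J∣ (spanned-size iK iJ (transfer iK S⊆clK))

  large-independent-basis : IsBasis M X → K ⊆ E → Indep K → ∣ X ∣ ≤ ∣ K ∣ → IsBasis M K
  large-independent-basis X-basis K⊆E iK ∣X∣≤∣K∣ =
    K⊆E , iK , λ K′ K⊆K′ _ iK′ → sym (⊆-size-≡ K⊆K′ (≤-trans (basis-size X-basis iK′) ∣X∣≤∣K∣))

module Contraction {n : ℕ} (M : Matroid n) {X : Subset n} (iX : Matroid.Indep M X) where
  open Matroid M

  private variable
    I J Z : Subset n

  Indep/X : Subset n → Set
  Indep/X I = I ⊆ E ─ X × Indep (I ∪ X)

  ∣∪X∣ : I ⊆ E ─ X → ∣ I ∪ X ∣ ≡ ∣ I ∣ + ∣ X ∣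
  ∣∪X∣ {I} I⊆E─X = ∣∪∣-disjoint I X (λ x∈I → ∈─⇒∉ (I⊆E─X x∈I))

  augment/X : Indep/X I → Indep/X J → ∣ I ∣ < ∣ J ∣ → ∃[ x ] (x ∈ J × x ∉ I × Indep/X (I ∪ ⁅ x ⁆))
  augment/X {I} {J} (I⊆ , iIX) (J⊆ , iJX) ∣I∣<∣J∣ with I3 iIX iJX ∣IX∣<∣JX∣
    where
    ∣IX∣<∣JX∣ : ∣ I ∪ X ∣ < ∣ J ∪ X ∣
    ∣IX∣<∣JX∣ = subst₂ _<_ (sym (∣∪X∣ I⊆)) (sym (∣∪X∣ J⊆)) (+-monoˡ-< ∣ X ∣ ∣I∣<∣J∣)
  ... | x , x∈J∪X , x∉I∪X , ind = x , x∈J , (λ x∈I → x∉I∪X (∈∪ˡ x∈I)) ,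
        ∪-⊆ I⊆ (⁅⁆-⊆ (J⊆ x∈J)) , I2 ind (∪-⊆ (∪-mono ∈∪ˡ (λ h → h)) (λ x∈X → ∈∪ˡ (∈∪ʳ x∈X)))
    where
    x∈J : x ∈ J
    x∈J with x∈p∪q⁻ J X x∈J∪X
    ... | inj₁ x∈J = x∈J
    ... | inj₂ x∈X = ⊥-elim (x∉I∪X (∈∪ʳ x∈X))

  M/X : Matroid n
  M/X = record
    { E = E ─ X
    ; Indep = Indep/X
    ; Indep-dec = λ I → (I ⊆? E ─ X) ×-dec Indep-dec (I ∪ X)
    ; Indep-⊆E = proj₁
    ; I1 = ⊥⊆ , I2 iX (∪-⊆ ⊥⊆ (λ h → h))
    ; I2 = λ { (J⊆ , iJX) I⊆J → (λ x∈I → J⊆ (I⊆J x∈I)) , I2 iJX (∪-mono I⊆J (λ h → h)) }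
    ; I3 = augment/X
    }

  contraction-minor : IsMinorVia M X ⊥ M/X
  contraction-minor =
    Indep-⊆E iX , ⊥⊆ , (λ { (_ , x∈X∩⊥) → ∉⊥ (proj₂ (x∈p∩q⁻ X ⊥ x∈X∩⊥)) }) ,
    cong (E ─_) (sym (∪-identityʳ X)) , λ I → forward I , backward I
    where
    X-basis : IsBasisOf M X X
    X-basis = (λ h → h) , iX , λ J X⊆J J⊆X _ → ⊆-antisym J⊆X X⊆J
    forward : ∀ I → Indep/X I → I ⊆ E ─ X × ∃[ J ] (IsBasisOf M X J × Indep (I ∪ J))
    forward I (I⊆ , iIX) = I⊆ , X , X-basis , iIX
    backward : ∀ I → I ⊆ E ─ X → ∃[ J ] (IsBasisOf M X J × Indep (I ∪ J)) → Indep/X I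
    backward I I⊆ (J , (J⊆X , iJ , J-maximal) , iIJ) =
      I⊆ , subst (λ J → Indep (I ∪ J)) (sym (J-maximal X J⊆X (λ h → h) iX)) iIJ

  contraction-basis : J ⊆ E ─ X → IsBasis M (J ∪ X) → IsBasis M/X J
  contraction-basis {J} J⊆ (_ , iJX , JX-maximal) = J⊆ , (J⊆ , iJX) , J-maximal
    where
    J-maximal : ∀ J′ → J ⊆ J′ → J′ ⊆ E ─ X → Indep/X J′ → J′ ≡ J
    J-maximal J′ J⊆J′ J′⊆ (_ , iJ′X) = ⊆-antisym J′⊆J J⊆J′
      where
      J′X≡JX : J′ ∪ X ≡ J ∪ X
      J′X≡JX = JX-maximal (J′ ∪ X) (∪-mono J⊆J′ (λ h → h)) (Indep-⊆E iJ′X) iJ′X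
      J′⊆J : J′ ⊆ J
      J′⊆J x∈J′ with x∈p∪q⁻ J X (subst (_ ∈_) J′X≡JX (∈∪ˡ x∈J′))
      ... | inj₁ x∈J = x∈J
      ... | inj₂ x∈X = ⊥-elim (∈─⇒∉ (J′⊆ x∈J′) x∈X)

  contraction-circuit : Z ⊆ E ─ X → ¬ Indep (Z ∪ X) → (∀ {z} → z ∈ Z → Indep ((Z - z) ∪ X)) → IsCircuit M/X Z
  contraction-circuit {Z} Z⊆ Z∪X-dep Z-z-indep =
    Z⊆ , (λ { (_ , ind) → Z∪X-dep ind }) , proper-indep
    where
    proper-indep : ∀ D → D ⊂ Z → Indep/X D
    proper-indep D (D⊆Z , w , w∈Z , w∉D) =
      (λ x∈D → Z⊆ (D⊆Z x∈D)) , I2 (Z-z-indep w∈Z) (∪-mono D⊆Z-w (λ h → h))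
      where
      D⊆Z-w : D ⊆ Z - w
      D⊆Z-w {x} x∈D = x∈p∧x≢y⇒x∈p-y (D⊆Z x∈D) λ { refl → w∉D x∈D }

module Construction
  {n : ℕ} (M : Matroid n) {a : ℕ} (2≤a : 2 ≤ a) {B : Subset n} (joint : IsJointSet M a B)
  {B₀ : Subset n} (B₀⊆B : B₀ ⊆ B)
  {h : ℕ} (Q T : Fin h → Subset n) (Q⊆B₀ : ∀ i → Q i ⊆ B₀) (T⊆B : ∀ i → T i ⊆ B)
  (∣Q∣≤∣T∣ : ∀ i → ∣ Q i ∣ ≤ ∣ T i ∣)
  (B₀-T-disjoint : ∀ i → Disjoint B₀ (T i))
  (T-disjoint : ∀ {x} i j → x ∈ T i → x ∈ T j → i ≡ j)
  (t : Fin h → Fin n) (T-circuit : ∀ i → IsCircuit M (T i ∪ ⁅ t i ⁆))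
  where
  open Matroid M
  open Closure M

  private variable
    i j : Fin h
    I K : Subset n
    b b′ c c′ e : Fin n

  B⊆E : B ⊆ E
  B⊆E = proj₁ (proj₁ joint)

  iB : Indep B
  iB = proj₁ (proj₂ (proj₁ joint))

  circuit⊈B : ∀ {Z} → IsCircuit M Z → ¬ Z ⊆ B
  circuit⊈B (_ , Z-dep , _) Z⊆B = Z-dep (I2 iB Z⊆B)

  triangle : x ∈ B → y ∈ B → x ≢ y → ∃[ e ] IsCircuit M (triple x y e)
  triangle {x} {y} x∈B y∈B x≢y with proj₂ joint (⁅ x ⁆ ∪ ⁅ y ⁆) (∪-⊆ (⁅⁆-⊆ x∈B) (⁅⁆-⊆ y∈B))
                                      (≤-reflexive (sym ∣xy∣≡2)) (subst (_≤ a) (sym ∣xy∣≡2) 2≤a)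
    where
    ∣xy∣≡2 : ∣ ⁅ x ⁆ ∪ ⁅ y ⁆ ∣ ≡ 2
    ∣xy∣≡2 = trans (∣∪⁅⁆∣ (λ y∈⁅x⁆ → x≢y (sym (x∈⁅y⁆⇒x≡y x y∈⁅x⁆)))) (cong suc (∣⁅x⁆∣≡1 x))
  ... | e , _ , circuit = e , circuit

  Paired : Fin h → Fin n → Fin n → Set
  Paired i b c = b ∈ Q i × c ∈ T i × pos (Q i) b ≡ pos (T i) c

  Unpaired : Fin n → Set
  Unpaired c = ∀ i b → ¬ Paired i b c

  partner : b ∈ Q i → ∃[ c ] Paired i b c
  partner {b} {i} b∈Q with pos-surjective (T i) (pos (Q i) b) (≤-trans (pos< (Q i) b∈Q) (∣Q∣≤∣T∣ i))
  ... | c , c∈T , pos≡ = c , b∈Q , c∈T , sym pos≡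

  paired-source : Paired i b c → Paired j b′ c → i ≡ j × b ≡ b′
  paired-source {i} (b∈Q , c∈T , pos≡) (b′∈Q , c∈T′ , pos≡′) with T-disjoint _ _ c∈T c∈T′
  ... | refl = refl , pos-injective (Q i) b∈Q b′∈Q (trans pos≡ (sym pos≡′))

  paired-target : Paired i b c → Paired i b c′ → c ≡ c′
  paired-target {i} (_ , c∈T , pos≡) (_ , c′∈T , pos≡′) = pos-injective (T i) c∈T c′∈T (trans (sym pos≡) pos≡′)

  paired? : ∀ c → Unpaired c ⊎ ∃[ i ] ∃[ b ] Paired i b c
  paired? c with any? (λ i → c ∈? T i)
  ... | no c∉T = inj₁ λ i b (_ , c∈T , _) → c∉T (i , c∈T)
  ... | yes (i , c∈T) with pos (T i) c <? ∣ Q i ∣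
  ...   | yes pos< with pos-surjective (Q i) (pos (T i) c) pos<
  ...     | b , b∈Q , pos≡ = inj₂ (i , b , b∈Q , c∈T , pos≡)
  paired? c | yes (i , c∈T) | no pos≮ = inj₁ unpaired
    where
    unpaired : Unpaired c
    unpaired j b (b∈Q , c∈T′ , pos≡) with T-disjoint _ _ c∈T c∈T′
    ... | refl = pos≮ (subst (_< ∣ Q i ∣) pos≡ (pos< (Q i) b∈Q))

  paired-triangle : Paired i b c → ∃[ y ] IsCircuit M (triple b c y)
  paired-triangle {i} (b∈Q , c∈T , _) =
    triangle (B₀⊆B (Q⊆B₀ i b∈Q)) (T⊆B i c∈T) λ { refl → B₀-T-disjoint i (Q⊆B₀ i b∈Q) c∈T }

  Choice : Fin n → Fin n → Set
  Choice c y = (y ≡ c × Unpaired c) ⊎ ∃[ i ] ∃[ b ] (Paired i b c × IsCircuit M (triple b c y))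

  choice : ∀ c → ∃[ y ] Choice c y
  choice c with paired? c
  ... | inj₁ unpaired = c , inj₁ (refl , unpaired)
  ... | inj₂ (i , b , paired) with paired-triangle paired
  ...   | y , circuit = y , inj₂ (i , b , paired , circuit)

  φ : Fin n → Fin n
  φ c = proj₁ (choice c)

  Y : Subset n
  Y = image φ (B ─ B₀)

  φ∈Y : c ∈ B → c ∉ B₀ → φ c ∈ Y
  φ∈Y c∈B c∉B₀ = image-∈ φ (x∈p∧x∉q⇒x∈p─q c∈B c∉B₀)

  Y-source : y ∈ Y → ∃[ c ] (c ∈ B × c ∉ B₀ × Choice c y)
  Y-source y∈Y with image-∈⁻ φ (B ─ B₀) y∈Y
  ... | c , c∈B─B₀ , refl = c , p─q⊆p B B₀ c∈B─B₀ , ∈─⇒∉ c∈B─B₀ , proj₂ (choice c)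

  Y⊆E : Y ⊆ E
  Y⊆E y∈Y with Y-source y∈Y
  ... | c , c∈B , _ , inj₁ (refl , _) = B⊆E c∈B
  ... | c , c∈B , _ , inj₂ (_ , _ , _ , (triangle⊆E , _)) = triangle⊆E (∈∪ʳ (x∈⁅x⁆ _))

  -- Y avoids B₀: a chosen element in B would put a triangle inside B.
  Y-B₀-disjoint : Disjoint Y B₀
  Y-B₀-disjoint y∈Y y∈B₀ with Y-source y∈Y
  ... | c , c∈B , c∉B₀ , inj₁ (refl , _) = c∉B₀ y∈B₀
  ... | c , c∈B , _ , inj₂ (i , b , (b∈Q , _ , _) , circuit) =
    circuit⊈B circuit (triple-⊆ (B₀⊆B (Q⊆B₀ i b∈Q)) c∈B (B₀⊆B y∈B₀))

  recover : Indep K → φ c ∈cl K → (∀ {i b} → Paired i b c → b ∈cl K) → c ∈cl K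
  recover {K} {c} iK φc∈clK partners∈clK = from (proj₂ (choice c))
    where
    from : Choice c (φ c) → c ∈cl K
    from (inj₁ (φc≡c , _)) = subst (_∈cl K) φc≡c φc∈clK
    from (inj₂ (_ , _ , paired , circuit)) =
      triangle-closure iK (subst (IsCircuit M) triple-swap circuit) (partners∈clK paired) φc∈clK

  chosen-triangle : Paired i b c → IsCircuit M (triple b c (φ c))
  chosen-triangle {i} {b} {c} paired = from (proj₂ (choice c))
    where
    from : Choice c (φ c) → IsCircuit M (triple b c (φ c))
    from (inj₁ (_ , unpaired)) = ⊥-elim (unpaired i b paired)
    from (inj₂ (_ , _ , paired′ , circuit)) with paired-source paired paired′
    ... | refl , refl = circuit

  K₀ : Subset n
  K₀ = B₀ ∪ Y

  B-spanned : Indep K → K₀ ⊆cl K → B ⊆cl K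
  B-spanned iK K₀⊆clK {b} b∈B with b ∈? B₀
  ... | yes b∈B₀ = K₀⊆clK (∈∪ˡ b∈B₀)
  ... | no b∉B₀ = recover iK (K₀⊆clK (∈∪ʳ (φ∈Y b∈B b∉B₀)))
                    λ { {i} (b′∈Q , _ , _) → K₀⊆clK (∈∪ˡ (Q⊆B₀ i b′∈Q)) }

  ∣K₀∣≤∣B∣ : ∣ K₀ ∣ ≤ ∣ B ∣
  ∣K₀∣≤∣B∣ = begin
    ∣ B₀ ∪ Y ∣            ≤⟨ ∣∪∣≤ B₀ Y ⟩
    ∣ B₀ ∣ + ∣ Y ∣         ≤⟨ +-monoʳ-≤ ∣ B₀ ∣ (image-size φ (B ─ B₀)) ⟩
    ∣ B₀ ∣ + ∣ B ─ B₀ ∣    ≡⟨ ∣∣+∣─∣ B B₀ B₀⊆B ⟩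
    ∣ B ∣                 ∎
    where open ≤-Reasoning

  -- B₀ ∪ Y spans the basis B and is no larger, so it is itself a basis.
  K₀-indep : Indep K₀
  K₀-indep = small-spanning-independent iB ∣K₀∣≤∣B∣ B-spanned

  K₀-basis : IsBasis M K₀
  K₀-basis = large-independent-basis (proj₁ joint) (∪-⊆ (λ x∈B₀ → B⊆E (B₀⊆B x∈B₀)) Y⊆E) K₀-indep
               (spanned-size K₀-indep iB (B-spanned K₀-indep inj₁))

  open Contraction M {Y} (I2 K₀-indep ∈∪ʳ) public using (contraction-minor) renaming (M/X to M/Y)
  open Contraction M {Y} (I2 K₀-indep ∈∪ʳ) using (contraction-basis; contraction-circuit)

  B₀⊆E─Y : B₀ ⊆ E ─ Y
  B₀⊆E─Y x∈B₀ = x∈p∧x∉q⇒x∈p─q (B⊆E (B₀⊆B x∈B₀)) (λ x∈Y → Y-B₀-disjoint x∈Y x∈B₀)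

  B₀-basis : IsBasis M/Y B₀
  B₀-basis = contraction-basis B₀⊆E─Y K₀-basis

  over-B₀-indep : I ⊆ B₀ → Indep (I ∪ Y)
  over-B₀-indep I⊆B₀ = I2 K₀-indep (∪-mono I⊆B₀ (λ h → h))

  φ-T∈Y : c ∈ T i → φ c ∈ Y
  φ-T∈Y {i = i} c∈T = φ∈Y (T⊆B i c∈T) λ c∈B₀ → B₀-T-disjoint i c∈B₀ c∈T

  T-recover : Indep K → Y ⊆ K → c ∈ T i → (∀ {b} → Paired i b c → b ∈cl K) → c ∈cl K
  T-recover {c = c} iK Y⊆K c∈T partner∈clK = recover iK (inj₁ (Y⊆K (φ-T∈Y c∈T))) λ paired →
    partner∈clK (subst (λ j → Paired j _ c) (T-disjoint _ _ (proj₁ (proj₂ paired)) c∈T) paired)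

  removed-unspanned : I ⊆ B₀ → b ∈ I → ¬ b ∈cl ((I - b) ∪ Y)
  removed-unspanned {I} {b} I⊆B₀ b∈I (inj₁ b∈rest) with x∈p∪q⁻ (I - b) Y b∈rest
  ... | inj₁ b∈I-b = proj₂ (∈-⁻ b∈I-b) refl
  ... | inj₂ b∈Y = Y-B₀-disjoint b∈Y (I⊆B₀ b∈I)
  removed-unspanned {I} {b} I⊆B₀ b∈I (inj₂ dep) =
    dep (I2 K₀-indep (∪-⊆ (∪-mono (λ x∈ → I⊆B₀ (-⊆ x∈)) (λ h → h)) (⁅⁆-⊆ (∈∪ˡ (I⊆B₀ b∈I)))))

  circuit/Y : I ⊆ B₀ → e ∈ E ─ Y → ¬ Indep ((I ∪ ⁅ e ⁆) ∪ Y) →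
              (∀ {b} → b ∈ I → ¬ e ∈cl ((I - b) ∪ Y)) → IsCircuit M/Y (I ∪ ⁅ e ⁆)
  circuit/Y {I} {e} I⊆B₀ e∈E─Y dep e-unspanned =
    contraction-circuit (∪-⊆ (λ x∈I → B₀⊆E─Y (I⊆B₀ x∈I)) (⁅⁆-⊆ e∈E─Y)) dep minus-indep
    where
    minus-indep : ∀ {z} → z ∈ I ∪ ⁅ e ⁆ → Indep (((I ∪ ⁅ e ⁆) - z) ∪ Y)
    minus-indep {z} z∈ with z ≟ e
    ... | yes refl = over-B₀-indep without-e
      where
      without-e : (I ∪ ⁅ e ⁆) - e ⊆ B₀
      without-e x∈ with ∈-⁻ x∈
      ... | x∈Ie , x≢e with x∈p∪q⁻ I ⁅ e ⁆ x∈Ie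
      ...   | inj₁ x∈I = I⊆B₀ x∈I
      ...   | inj₂ x∈⁅e⁆ = ⊥-elim (x≢e (x∈⁅y⁆⇒x≡y e x∈⁅e⁆))
    ... | no z≢e = I2 (∉cl⇒Indep (e-unspanned z∈I)) (∪-⊆ without-z (λ x∈Y → ∈∪ˡ (∈∪ʳ x∈Y)))
      where
      z∈I : z ∈ I
      z∈I with x∈p∪q⁻ I ⁅ e ⁆ z∈
      ... | inj₁ z∈I = z∈I
      ... | inj₂ z∈⁅e⁆ = ⊥-elim (z≢e (x∈⁅y⁆⇒x≡y e z∈⁅e⁆))
      without-z : (I ∪ ⁅ e ⁆) - z ⊆ ((I - z) ∪ Y) ∪ ⁅ e ⁆
      without-z x∈ with ∈-⁻ x∈
      ... | x∈Ie , x≢z with x∈p∪q⁻ I ⁅ e ⁆ x∈Ie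
      ...   | inj₁ x∈I = ∈∪ˡ (∈∪ˡ (x∈p∧x≢y⇒x∈p-y x∈I x≢z))
      ...   | inj₂ x∈⁅e⁆ = ∈∪ʳ x∈⁅e⁆

  surviving-circuit : I ⊆ B₀ → IsCircuit M (I ∪ ⁅ e ⁆) → IsCircuit M/Y (I ∪ ⁅ e ⁆)
  surviving-circuit {I} {e} I⊆B₀ circuit@(Ie⊆E , Ie-dep , _) =
    circuit/Y I⊆B₀ (x∈p∧x∉q⇒x∈p─q e∈E e∉Y) (λ ind → Ie-dep (I2 ind ∈∪ˡ)) e-unspanned
    where
    e∈E : e ∈ E
    e∈E = Ie⊆E (∈∪ʳ (x∈⁅x⁆ e))
    e∉Y : e ∉ Y
    e∉Y e∈Y = Ie-dep (I2 K₀-indep (∪-⊆ (λ x∈I → ∈∪ˡ (I⊆B₀ x∈I)) (⁅⁆-⊆ (∈∪ʳ e∈Y))))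
    -- If e were spanned, then so would b by circuit closure.
    e-unspanned : ∀ {b} → b ∈ I → ¬ e ∈cl ((I - b) ∪ Y)
    e-unspanned {b} b∈I e∈cl = removed-unspanned I⊆B₀ b∈I
      (circuit-closure (over-B₀-indep (λ x∈ → I⊆B₀ (-⊆ x∈))) circuit (∈∪ˡ b∈I) others)
      where
      others : (I ∪ ⁅ e ⁆) - b ⊆cl ((I - b) ∪ Y)
      others x∈ with ∈-⁻ x∈
      ... | x∈Ie , x≢b with x∈p∪q⁻ I ⁅ e ⁆ x∈Ie
      ...   | inj₁ x∈I = inj₁ (∈∪ˡ (x∈p∧x≢y⇒x∈p-y x∈I x≢b))
      ...   | inj₂ x∈⁅e⁆ = subst (_∈cl ((I - b) ∪ Y)) (sym (x∈⁅y⁆⇒x≡y e x∈⁅e⁆)) e∈cl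

  -- Otherwise
  -- every element of the circuit T i ∪ {t i} other than the partner c of b is
  -- spanned, hence c is, and then b is, via the triangle {b, c, φ c}.
  t-unspanned : b ∈ Q i → ¬ t i ∈cl ((Q i - b) ∪ Y)
  t-unspanned {b} {i} b∈Q t∈cl = removed-unspanned (Q⊆B₀ i) b∈Q b-spanned
    where
    rest : Subset n
    rest = (Q i - b) ∪ Y
    rest-indep : Indep rest
    rest-indep = over-B₀-indep (λ x∈ → Q⊆B₀ i (-⊆ x∈))
    d : Fin n
    d = proj₁ (partner b∈Q)
    b~d : Paired i b d
    b~d = proj₂ (partner b∈Q)
    d∈T : d ∈ T i
    d∈T = proj₁ (proj₂ b~d)
    others : (T i ∪ ⁅ t i ⁆) - d ⊆cl rest
    others {s} s∈ with ∈-⁻ s∈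
    ... | s∈Tt , s≢d with x∈p∪q⁻ (T i) ⁅ t i ⁆ s∈Tt
    ...   | inj₂ s∈⁅t⁆ = subst (_∈cl rest) (sym (x∈⁅y⁆⇒x≡y (t i) s∈⁅t⁆)) t∈cl
    ...   | inj₁ s∈T = T-recover rest-indep ∈∪ʳ s∈T partner-spanned
      where
      -- The partner of s ≠ d is not b, so it lies in Q i - b.
      partner-spanned : ∀ {b′} → Paired i b′ s → b′ ∈cl rest
      partner-spanned {b′} b′~s@(b′∈Q , _) with b′ ≟ b
      ... | yes refl = ⊥-elim (s≢d (paired-target b′~s b~d))
      ... | no b′≢b = inj₁ (∈∪ˡ (x∈p∧x≢y⇒x∈p-y b′∈Q b′≢b))
    d-spanned : d ∈cl rest
    d-spanned = circuit-closure rest-indep (T-circuit i) (∈∪ˡ d∈T) others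
    b-spanned : b ∈cl rest
    b-spanned = triangle-closure rest-indep (chosen-triangle b~d) d-spanned (inj₁ (∈∪ʳ (φ-T∈Y d∈T)))

  new-circuit : b ∈ Q i → IsCircuit M/Y (Q i ∪ ⁅ t i ⁆)
  new-circuit {b} {i} b∈Q = circuit/Y (Q⊆B₀ i) (x∈p∧x∉q⇒x∈p─q t∈E t∉Y) dependent (t-unspanned {i = i})
    where
    t∈E : t i ∈ E
    t∈E = proj₁ (T-circuit i) (∈∪ʳ (x∈⁅x⁆ (t i)))
    t∉Y : t i ∉ Y
    t∉Y t∈Y = t-unspanned b∈Q (inj₁ (∈∪ʳ t∈Y))
    t∉B : t i ∉ B
    t∉B t∈B = circuit⊈B (T-circuit i) (∪-⊆ (T⊆B i) (⁅⁆-⊆ t∈B))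
    -- T i is spanned by Q i ∪ Y, hence so is t i, by circuit closure.
    t-spanned : t i ∈cl (Q i ∪ Y)
    t-spanned = circuit-closure (over-B₀-indep (Q⊆B₀ i)) (T-circuit i) (∈∪ʳ (x∈⁅x⁆ (t i))) T-spanned
      where
      T-spanned : (T i ∪ ⁅ t i ⁆) - t i ⊆cl (Q i ∪ Y)
      T-spanned s∈ with ∈-⁻ s∈
      ... | s∈Tt , s≢t with x∈p∪q⁻ (T i) ⁅ t i ⁆ s∈Tt
      ...   | inj₂ s∈⁅t⁆ = ⊥-elim (s≢t (x∈⁅y⁆⇒x≡y (t i) s∈⁅t⁆))
      ...   | inj₁ s∈T = T-recover (over-B₀-indep (Q⊆B₀ i)) ∈∪ʳ s∈T λ (b′∈Q , _) → inj₁ (∈∪ˡ b′∈Q)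
    dependent : ¬ Indep ((Q i ∪ ⁅ t i ⁆) ∪ Y)
    dependent ind with t-spanned
    ... | inj₂ dep = dep (I2 ind (∪-⊆ (∪-mono ∈∪ˡ (λ h → h)) (λ x∈ → ∈∪ˡ (∈∪ʳ x∈))))
    ... | inj₁ t∈QY with x∈p∪q⁻ (Q i) Y t∈QY
    ...   | inj₁ t∈Q = t∉B (B₀⊆B (Q⊆B₀ i t∈Q))
    ...   | inj₂ t∈Y = t∉Y t∈Y

  joint-set/Y : (∀ I → I ⊆ B₀ → ∣ I ∣ ≡ a + 1 → ∃[ i ] Q i ≡ I) → IsJointSet M/Y (a + 1) B₀
  joint-set/Y Q-onto = B₀-basis , circuits
    where
    circuits : ∀ I → I ⊆ B₀ → 2 ≤ ∣ I ∣ → ∣ I ∣ ≤ a + 1 →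
               ∃[ e ] (e ∈ Matroid.E M/Y × IsCircuit M/Y (I ∪ ⁅ e ⁆))
    circuits I I⊆B₀ 2≤∣I∣ ∣I∣≤a+1 with ∣ I ∣ ≤? a
    ... | yes ∣I∣≤a with proj₂ joint I (λ x∈I → B₀⊆B (I⊆B₀ x∈I)) 2≤∣I∣ ∣I∣≤a
    ...   | e , _ , circuit = e , proj₁ (surviving-circuit I⊆B₀ circuit) (∈∪ʳ (x∈⁅x⁆ e)) ,
                              surviving-circuit I⊆B₀ circuit
    circuits I I⊆B₀ 2≤∣I∣ ∣I∣≤a+1 | no ∣I∣≰a with Q-onto I I⊆B₀ ∣I∣≡a+1
      where
      ∣I∣≡a+1 : ∣ I ∣ ≡ a + 1
      ∣I∣≡a+1 = ≤-antisym ∣I∣≤a+1 (subst (_≤ ∣ I ∣) (+-comm 1 a) (≰⇒> ∣I∣≰a))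
    ... | i , refl with nonempty {p = Q i} (≤-trans (s≤s z≤n) 2≤∣I∣)
    ...   | b , b∈Q = t i , proj₁ (new-circuit b∈Q) (∈∪ʳ (x∈⁅x⁆ (t i))) , new-circuit b∈Q

-- Lemma 4.1.  Take B₀ ⊆ Bs 0 of size m, let Q enumerate the (a+1)-subsets of
-- B₀ and T i = Bs (suc i); the construction above yields the minor M / Y.
lemma4p1 : (m a : ℕ) → 2 ≤ a → a < m →
    (n : ℕ) (M : Matroid n) (B : Subset n) → IsJointSet M a B →
    (Bs : Fin (suc (m C (a + 1))) → Subset n) →
    (∀ i → Bs i ⊆ B) →
    (∀ i j → i ≢ j → Empty (Bs i ∩ Bs j)) →
    ∣ Bs zero ∣ ≥ m →
    (∀ i → a < ∣ Bs (suc i) ∣ × ∃[ x ] (x ∈ Matroid.E M × IsCircuit M (Bs (suc i) ∪ ⁅ x ⁆))) →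
    ∃[ N ] (IsMinor M N × IsComplete N (a + 1) × HasRank N m)
lemma4p1 m a 2≤a _ n M B joint Bs Bs⊆B disjoint ∣Bs₀∣≥m circuits with choose (Bs zero) m ∣Bs₀∣≥m
... | B₀ , B₀⊆Bs₀ , ∣B₀∣≡m =
  M/Y , (Y , ⊥ , contraction-minor) , (B₀ , joint-set/Y Q-onto) , (B₀ , B₀-basis , ∣B₀∣≡m)
  where
  Q T : Fin (m C (a + 1)) → Subset n
  Q i = unrank B₀ (a + 1) (toℕ i)
  T i = Bs (suc i)

  Q-onto : ∀ I → I ⊆ B₀ → ∣ I ∣ ≡ a + 1 → ∃[ i ] Q i ≡ I
  Q-onto I I⊆B₀ ∣I∣≡a+1 with unrank-onto B₀ I (a + 1) I⊆B₀ ∣I∣≡a+1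
  ... | r , r<∣B₀∣C , unrank≡I = fromℕ< r<h , trans (cong (unrank B₀ (a + 1)) (toℕ-fromℕ< r<h)) unrank≡I
    where
    r<h : r < m C (a + 1)
    r<h = subst (λ k → r < k C (a + 1)) ∣B₀∣≡m r<∣B₀∣C

  same-index : ∀ {x} i j → x ∈ Bs i → x ∈ Bs j → i ≡ j
  same-index = disjoint-index Bs disjoint

  t : Fin (m C (a + 1)) → Fin n
  t i = proj₁ (proj₂ (circuits i))

  open Construction M 2≤a joint (λ x∈B₀ → Bs⊆B zero (B₀⊆Bs₀ x∈B₀)) Q T
    (λ i → unrank-⊆ B₀ (a + 1) (toℕ i)) (λ i → Bs⊆B (suc i))
    (λ i → ≤-trans (unrank-size B₀ (a + 1) (toℕ i)) (subst (_≤ ∣ T i ∣) (+-comm 1 a) (proj₁ (circuits i))))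
    (λ i x∈B₀ x∈T → zero≢suc (same-index zero (suc i) (B₀⊆Bs₀ x∈B₀) x∈T))
    (λ i j x∈Ti x∈Tj → Fin-suc-injective (same-index (suc i) (suc j) x∈Ti x∈Tj))
    t (λ i → proj₂ (proj₂ (proj₂ (circuits i))))
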